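{- If $G$ is an Ore composition of a graph $H$ and $K_k$ (with $K_k$ as either the edge side or the split side), then $T^{k-1}(G) \geq T^{k-1}(H)$.
   Context: Ore composition of $H_1,H_2$: delete an edge $xy$ of $H_1$ (edge side); split a vertex $z$ of $H_2$ (split side) into two vertices $z_1,z_2$ of positive degree with $N(z_1)\cup N(z_2)=N(z)$ and $N(z_1)\cap N(z_2)=\emptyset$; identify $x$ with $z_1$ and $y$ with $z_2$. $T^{k-1}(G)$ is the maximum number of pairwise vertex-disjoint $K_{k-1}$ subgraphs of $G$. -}

module Defs where

open import Data.Nat using (ℕ; zero; suc; _≤_)
open import Data.Fin using (Fin; punchIn)
open import Data.Fin.Properties using (_≟_)
open import Data.Bool using (Bool; true; false)
open import Data.Sum using (_⊎_; inj₁; inj₂)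
open import Data.Product using (Σ; Σ-syntax; ∃; ∃-syntax; _×_; _,_)
open import Data.Empty using (⊥)
open import Relation.Nullary using (¬_)
open import Relation.Binary.PropositionalEquality using (_≡_; _≢_; ≢-sym)
open import Function.Bundles using (_↔_; Inverse)

record Graph (n : ℕ) : Set₁ where
  field
    Adj    : Fin n → Fin n → Set
    sym    : ∀ {u v} → Adj u v → Adj v u
    irrefl : ∀ {v} → ¬ Adj v v
open Graph public

K : (k : ℕ) → Graph k
K k = record { Adj = λ i j → i ≢ j ; sym = ≢-sym ; irrefl = λ p → p _≡_.refl }

-- A family of m pairwise vertex-disjoint copies of K_r in a graph with
-- adjacency Adj: copy p is given by f p : Fin r → V, whose images are
-- pairwise adjacent (hence distinct, by irreflexivity), and distinct
-- copies share no vertex.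
CliquePacking : {V : Set} → (V → V → Set) → (r m : ℕ) → Set
CliquePacking {V} Adj r m =
  Σ[ f ∈ (Fin m → Fin r → V) ]
    ((∀ p i j → i ≢ j → Adj (f p i) (f p j)) ×
     (∀ p q i j → p ≢ q → f p i ≢ f q j))

IsT : ∀ {n} → (r : ℕ) → Graph n → ℕ → Set
IsT r G t = CliquePacking (Adj G) r t × (∀ m → CliquePacking (Adj G) r m → m ≤ t)

-- Ore composition data, with edge side H1 on Fin a and split side H2 on
-- Fin (suc b).  The split vertex z is removed; the remaining vertices of
-- H2 are Fin b, embedded via punchIn z.  The side function s assigns each
-- neighbour of z to z₁ (true) or z₂ (false); this gives exactly the
-- partitions N(z₁) ⊎ N(z₂) = N(z) with N(z₁) ∩ N(z₂) = ∅.
-- x is identified with z₁, y with z₂, and the edge xy is deleted.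
module _ {a b : ℕ} (H1 : Graph a) (H2 : Graph (suc b))
         (x y : Fin a) (z : Fin (suc b)) (s : Fin b → Bool) where

  NbrSide : Bool → Fin b → Set
  NbrSide β v = Adj H2 z (punchIn z v) × s v ≡ β

  IsXY : Fin a → Fin a → Set
  IsXY u v = (u ≡ x × v ≡ y) ⊎ (u ≡ y × v ≡ x)

  CrossAdj : Fin a → Fin b → Set
  CrossAdj u v = (u ≡ x × NbrSide true v) ⊎ (u ≡ y × NbrSide false v)

  OreAdj : (Fin a ⊎ Fin b) → (Fin a ⊎ Fin b) → Set
  OreAdj (inj₁ u) (inj₁ v) = Adj H1 u v × ¬ IsXY u v
  OreAdj (inj₂ u) (inj₂ v) = Adj H2 (punchIn z u) (punchIn z v)
  OreAdj (inj₁ u) (inj₂ v) = CrossAdj u v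
  OreAdj (inj₂ u) (inj₁ v) = CrossAdj v u

IsoTo : ∀ {n} {W : Set} → Graph n → (W → W → Set) → Set
IsoTo {n} {W} G R =
  Σ[ φ ∈ (Fin n ↔ W) ]
    (∀ u v → (Adj G u v → R (Inverse.to φ u) (Inverse.to φ v)) ×
             (R (Inverse.to φ u) (Inverse.to φ v) → Adj G u v))

-- G is an Ore composition of H1 (edge side) and H2 (split side).
-- Positive degree of z₁ and z₂ means each receives some neighbour of z.
OreComposition : ∀ {n a c} → Graph n → Graph a → Graph c → Set
OreComposition {n} {a} {zero}  G H1 H2 = ⊥
OreComposition {n} {a} {suc b} G H1 H2 =
  Σ[ x ∈ Fin a ] Σ[ y ∈ Fin a ] Σ[ z ∈ Fin (suc b) ] Σ[ s ∈ (Fin b → Bool) ]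
    (Adj H1 x y ×
     (∃[ w ] NbrSide H1 H2 x y z s true w) ×
     (∃[ w ] NbrSide H1 H2 x y z s false w) ×
     IsoTo G (OreAdj H1 H2 x y z s))

-- A maximum K_{k-1}-packing of H survives in G after changing at most one
-- copy.  If H is the edge side, only the copy containing both x and y can
-- use the deleted edge xy; if H is the split side, only the copy through z
-- is affected.  By disjointness there is at most one such copy, and it is
-- replaced by a K_{k-1} of the K_k side that is still complete in G and
-- disjoint from H's remaining vertices: K_k − z in the first case, K_k − x
-- in the second.
module Submission where

open import Defs hiding (sym)
open import Data.Nat using (ℕ; zero; suc; _≤_; _∸_)
open import Data.Bool using (Bool)
open import Data.Sum using (_⊎_; inj₁; inj₂)
open import Data.Sum.Properties using (inj₁-injective; inj₂-injective)
open import Data.Fin using (Fin; punchIn; punchOut)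
open import Data.Fin.Properties
  using (_≟_; any?; punchIn-injective; punchInᵢ≢i; punchIn-punchOut; punchOut-injective)
open import Data.Product using (Σ-syntax; ∃; _×_; _,_; proj₂)
open import Data.Empty using (⊥)
open import Function using (_∘_)
open import Function.Bundles using (Inverse; Injection)
open import Function.Properties.Inverse using (↔-sym; ↔⇒↣)
open import Function.Definitions using (Injective)
open import Relation.Nullary using (¬_; yes; no)
open import Relation.Nullary.Decidable using (_×-dec_)
open import Relation.Unary using (Decidable)
open import Relation.Binary.PropositionalEquality
  using (_≡_; _≢_; sym; trans; subst₂)

IsT-mono : ∀ {n m r tG tH} (G : Graph n) (H : Graph m) →
           IsT r G tG → IsT r H tH →
           (CliquePacking (Adj H) r tH → CliquePacking (Adj G) r tH) → tH ≤ tG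
IsT-mono G H (_ , maximal) (packingH , _) transfer = maximal _ (transfer packingH)

CliquePacking-map : ∀ {V W : Set} {R : V → V → Set} {S : W → W → Set} (h : V → W) →
                    (∀ {u v} → R u v → S (h u) (h v)) → Injective _≡_ _≡_ h →
                    ∀ {r t} → CliquePacking R r t → CliquePacking S r t
CliquePacking-map h hom inj (f , clique , disjoint) =
  (λ p → h ∘ f p) ,
  (λ p i j i≢j → hom (clique p i j i≢j)) ,
  (λ p q i j p≢q → disjoint p q i j p≢q ∘ inj)

IsoTo-packing : ∀ {n} {W : Set} (G : Graph n) (R : W → W → Set) → IsoTo G R →
                ∀ {r t} → CliquePacking R r t → CliquePacking (Adj G) r t
IsoTo-packing G R (φ , G≅R) =
  CliquePacking-map {S = Adj G} from from-hom (Injection.injective (↔⇒↣ (↔-sym φ)))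
  where
  open Inverse φ

  from-hom : ∀ {u v} → R u v → Adj G (from u) (from v)
  from-hom {u} {v} Ruv = proj₂ (G≅R (from u) (from v))
    (subst₂ R (sym (strictlyInverseˡ u)) (sym (strictlyInverseˡ v)) Ruv)

-- There is at most one special copy, so it may be replaced by any clique κ
-- that the other copies avoid.
module _ {W : Set} {S : W → W → Set} {r t : ℕ}
         (Special : Fin t → Set) (special? : Decidable Special)
         (special-unique : ∀ {p q} → p ≢ q → Special p → Special q → ⊥)
         (κ : Fin r → W) (κ-clique : ∀ i j → i ≢ j → S (κ i) (κ j))
         (keep : ∀ p → ¬ Special p → Fin r → W)
         (keep-clique : ∀ p sp i j → i ≢ j → S (keep p sp i) (keep p sp j))
         (keep-disjoint : ∀ p q sp sq i j → p ≢ q → keep p sp i ≢ keep q sq j)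
         (keep-avoids-κ : ∀ p sp i j → keep p sp i ≢ κ j) where

  packing-replacing-special-copy : CliquePacking S r t
  packing-replacing-special-copy = copy , clique , disjoint
    where
    copy : Fin t → Fin r → W
    copy p with special? p
    ... | yes _  = κ
    ... | no ¬sp = keep p ¬sp

    clique : ∀ p i j → i ≢ j → S (copy p i) (copy p j)
    clique p with special? p
    ... | yes _  = κ-clique
    ... | no ¬sp = keep-clique p ¬sp

    disjoint : ∀ p q i j → p ≢ q → copy p i ≢ copy q j
    disjoint p q i j p≢q with special? p | special? q
    ... | yes sp  | yes sq  = λ _ → special-unique p≢q sp sq
    ... | yes _   | no ¬sq  = keep-avoids-κ q ¬sq j i ∘ sym
    ... | no ¬sp  | yes _   = keep-avoids-κ p ¬sp i j
    ... | no ¬sp  | no ¬sq  = keep-disjoint p q ¬sp ¬sq i j p≢q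

packing-from-edge-side : ∀ {m b t} (H : Graph m) (x y : Fin m)
                         (z : Fin (suc b)) (s : Fin b → Bool) →
                       CliquePacking (Adj H) b t →
                       CliquePacking (OreAdj H (K (suc b)) x y z s) b t
packing-from-edge-side {b = b} {t} H x y z s (f , clique , disjoint) =
  packing-replacing-special-copy {S = OreAdj H (K (suc b)) x y z s} UsesXY usesXY? unique
    inj₂ (λ i j i≢j → i≢j ∘ punchIn-injective z i j)
    (λ p _ → inj₁ ∘ f p) keep-clique
    (λ p q _ _ i j p≢q → disjoint p q i j p≢q ∘ inj₁-injective) (λ _ _ _ _ ())
  where
  UsesXY : Fin t → Set
  UsesXY p = Σ[ i ∈ Fin b ] Σ[ j ∈ Fin b ] (f p i ≡ x × f p j ≡ y)

  usesXY? : Decidable UsesXY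
  usesXY? p = any? λ i → any? λ j → (f p i ≟ x) ×-dec (f p j ≟ y)

  unique : ∀ {p q} → p ≢ q → UsesXY p → UsesXY q → ⊥
  unique p≢q (i , _ , eᵢ , _) (i′ , _ , eᵢ′ , _) =
    disjoint _ _ i i′ p≢q (trans eᵢ (sym eᵢ′))

  keep-clique : ∀ p → ¬ UsesXY p → ∀ i j → i ≢ j →
                OreAdj H (K (suc b)) x y z s (inj₁ (f p i)) (inj₁ (f p j))
  keep-clique p ¬uses i j i≢j = clique p i j i≢j , λ
    { (inj₁ (eˣ , eʸ)) → ¬uses (i , j , eˣ , eʸ)
    ; (inj₂ (eʸ , eˣ)) → ¬uses (j , i , eˣ , eʸ) }

packing-from-split-side : ∀ {k b t} (H : Graph (suc b)) (x y : Fin (suc k))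
                          (z : Fin (suc b)) (s : Fin b → Bool) →
                        CliquePacking (Adj H) k t →
                        CliquePacking (OreAdj (K (suc k)) H x y z s) k t
packing-from-split-side {k} {b} {t} H x y z s (f , clique , disjoint) =
  packing-replacing-special-copy {S = OreAdj (K (suc k)) H x y z s} HitsZ hitsZ? unique
    (inj₁ ∘ punchIn x) κ-clique
    (λ p ¬hits → inj₂ ∘ survivor p ¬hits) keep-clique
    (λ p q ¬hp ¬hq i j p≢q → survivor-disjoint p q ¬hp ¬hq i j p≢q ∘ inj₂-injective)
    (λ _ _ _ _ ())
  where
  HitsZ : Fin t → Set
  HitsZ p = ∃ λ i → f p i ≡ z

  hitsZ? : Decidable HitsZ
  hitsZ? p = any? λ i → f p i ≟ z

  unique : ∀ {p q} → p ≢ q → HitsZ p → HitsZ q → ⊥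
  unique p≢q (i , eᵢ) (j , eⱼ) = disjoint _ _ i j p≢q (trans eᵢ (sym eⱼ))

  κ-clique : ∀ i j → i ≢ j →
             OreAdj (K (suc k)) H x y z s (inj₁ (punchIn x i)) (inj₁ (punchIn x j))
  κ-clique i j i≢j = i≢j ∘ punchIn-injective x i j , λ
    { (inj₁ (e , _)) → punchInᵢ≢i x i e
    ; (inj₂ (_ , e)) → punchInᵢ≢i x j e }

  avoids-z : ∀ p → ¬ HitsZ p → ∀ i → z ≢ f p i
  avoids-z p ¬hits i e = ¬hits (i , sym e)

  survivor : ∀ p → ¬ HitsZ p → Fin k → Fin b
  survivor p ¬hits i = punchOut (avoids-z p ¬hits i)

  keep-clique : ∀ p ¬hits i j → i ≢ j →
                Adj H (punchIn z (survivor p ¬hits i)) (punchIn z (survivor p ¬hits j))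
  keep-clique p ¬hits i j i≢j =
    subst₂ (Adj H) (sym (punchIn-punchOut _)) (sym (punchIn-punchOut _)) (clique p i j i≢j)

  survivor-disjoint : ∀ p q ¬hp ¬hq i j → p ≢ q → survivor p ¬hp i ≢ survivor q ¬hq j
  survivor-disjoint p q ¬hp ¬hq i j p≢q =
    disjoint p q i j p≢q ∘ punchOut-injective (avoids-z p ¬hp i) (avoids-z q ¬hq j)

corollary2p5 : (k n m : ℕ) (G : Graph n) (H : Graph m) →
               (OreComposition G H (K k) ⊎ OreComposition G (K k) H) →
               (tG tH : ℕ) → IsT (k ∸ 1) G tG → IsT (k ∸ 1) H tH → tH ≤ tG
corollary2p5 zero n m G H (inj₁ ()) tG tH TG TH
corollary2p5 (suc b) n m G H (inj₁ (x , y , z , s , _ , _ , _ , G≅)) tG tH TG TH =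
  IsT-mono G H TG TH
    (IsoTo-packing G (OreAdj H (K (suc b)) x y z s) G≅ ∘ packing-from-edge-side H x y z s)
corollary2p5 k n zero G H (inj₂ ()) tG tH TG TH
corollary2p5 zero n (suc b) G H (inj₂ (() , _)) tG tH TG TH
corollary2p5 (suc k) n (suc b) G H (inj₂ (x , y , z , s , _ , _ , _ , G≅)) tG tH TG TH =
  IsT-mono G H TG TH
    (IsoTo-packing G (OreAdj (K (suc k)) H x y z s) G≅ ∘ packing-from-split-side H x y z s)
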